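{- Let $K$ be a Kripke structure over $AP$ and $s$ a state of $K$. Then for every $\mathsf{CTL}^*_\infty$ state formula $\varphi$: $s\models\varphi$ in $K$ iff $s\models\mathsf D(\varphi)$ in $D(K)$; and for every $\mathsf{CTL}^*_\delta$ state formula $\varphi$: $s\models\varphi$ in $D(K)$ iff $s\models\mathsf E(\varphi)$ in $K$.
   Context: Kripke structure: $(S,L,\to)$, $L:S\to2^{AP}$, $\to\subseteq S\times S$ (not necessarily total). Paths $s_0,s_1,\dots$ (finite or infinite) with $s_k\to s_{k+1}$; maximal if infinite or ending in a state without successor; suffixes obtained by deleting a finite initial segment. $\mathsf{CTL}^*_{ -\mathsf X}$ over a set $P$ of propositions: state formulas $\varphi::=p\mid\neg\varphi\mid\bigwedge\Phi\mid\exists\psi$, path formulas $\psi::=\varphi\mid\neg\psi\mid\bigwedge\Psi\mid\psi\,\mathsf U\,\psi$ ($p\in P$, $\Phi,\Psi$ arbitrary sets). $\mathsf{CTL}^*_\infty$: $\mathsf{CTL}^*_{ -\mathsf X}$ over $AP$ with the extra path formula $\infty$. $\mathsf{CTL}^*_\delta$: $\mathsf{CTL}^*_{ -\mathsf X}$ over $AP\cup\{\delta\}$, $\delta\notin AP$. Validity: $s\models p$ iff $p\in L(s)$; $\neg,\bigwedge$ as usual; $s\models\exists\psi$ iff some maximal path from $s$ satisfies $\psi$; a maximal path satisfies a state formula iff its first state does; $\pi\models\psi\,\mathsf U\,\psi'$ iff some suffix $\pi'$ of $\pi$ satisfies $\psi'$ and every suffix $\pi''$ of $\pi$ having $\pi'$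 as proper suffix satisfies $\psi$; $\pi\models\infty$ iff $\pi$ is infinite. $\top$ is the empty conjunction, $\mathsf F\psi=\top\,\mathsf U\,\psi$, $\mathsf G\psi=\neg\mathsf F\neg\psi$. The deadlock extension $D(K)$ adds a fresh state $s_\delta$ with label $\{\delta\}$ and transitions $s_\delta\to s_\delta$ and $d\to s_\delta$ for every state $d$ of $K$ without successor. The map $\mathsf D$ from $\mathsf{CTL}^*_\infty$ to $\mathsf{CTL}^*_\delta$ formulas (state and path): $\mathsf D(p)=p$; $\mathsf D(\neg\varphi)=\neg\delta\wedge\neg\mathsf D(\varphi)$ (for state and path formulas alike); $\mathsf D(\bigwedge_i\varphi_i)=\bigwedge_i\mathsf D(\varphi_i)$; $\mathsf D(\exists\psi)=\exists\mathsf D(\psi)$; $\mathsf D(\psi\,\mathsf U\,\psi')=\mathsf D(\psi)\,\mathsf U\,\mathsf D(\psi')$; $\mathsf D(\infty)=\neg\mathsf F\delta$. The map $\mathsf E$ from $\mathsf{CTL}^*_\delta$ to $\mathsf{CTL}^*_\infty$: $\mathsf E(p)=p$ for $p\in AP$; $\mathsf E(\delta)=\neg\top$; $\mathsf E$ commutes with $\neg$, $\bigwedge$ and $\exists$; $\mathsf E(\psi\,\mathsf U\,\psi')=\big(\neg\infty\wedge\mathsf G\,\mathsf E(\psi)\big)\vee\big(\mathsf E(\psi)\,\mathsf U\,\mathsf E(\psi')\big)$ if $s_\delta\models\exists\psi'$ (evaluated in the one-state Kripke structure consisting of $s_\delta$ labelled $\{\delta\}$ with a self-loop), and $\mathsf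 E(\psi\,\mathsf U\,\psi')=\mathsf E(\psi)\,\mathsf U\,\mathsf E(\psi')$ otherwise. -}

module Defs where

open import Level using (0ℓ)
open import Data.Nat using (ℕ; zero; suc; _≤_; _<_)
open import Data.Bool using (Bool; true; false; if_then_else_)
open import Data.Maybe using (Maybe; just; nothing)
open import Data.Unit using (⊤; tt)
open import Data.Empty using (⊥; ⊥-elim)
open import Data.Product using (Σ; ∃; _×_; _,_)
open import Data.Sum using (_⊎_)
open import Relation.Nullary using (¬_; Dec; does)
open import Relation.Binary.PropositionalEquality using (_≡_)
open import Axiom.ExcludedMiddle using (ExcludedMiddle)

-- Kripke structures over a set of propositions Q.
-- L : S → 2^Q is given as a predicate (subset) L s : Q → Set.

record Kripke (Q : Set) : Set₁ where
  field
    State : Set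
    L     : State → Q → Set
    _⟶_   : State → State → Set
open Kripke public

-- Paths: finite (with n+1 states, indices 0..n) or infinite.

data Len : Set where
  fin : ℕ → Len
  inf : Len

InRange : Len → ℕ → Set
InRange (fin n) k = k ≤ n
InRange inf     k = ⊤

record Path {Q : Set} (K : Kripke Q) : Set where
  field
    len  : Len
    seq  : ℕ → State K
    step : ∀ k → InRange len (suc k) → _⟶_ K (seq k) (seq (suc k))
open Path public

Maximal : {Q : Set} {K : Kripke Q} → Path K → Set
Maximal {K = K} π with len π
... | inf   = ⊤
... | fin n = ¬ (Σ (State K) λ t → _⟶_ K (seq π n) t)

-- Syntax of CTL*_{-X} over propositions P; index true allows the extra
-- path formula ∞ (CTL*_∞ uses true, CTL*_δ uses false).
-- Conjunctions are over arbitrary (index) sets.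

mutual
  data SF (P : Set) : Bool → Set₁ where
    atom : ∀ {b} → P → SF P b
    ¬ˢ   : ∀ {b} → SF P b → SF P b
    ⋀ˢ   : ∀ {b} → (I : Set) → (I → SF P b) → SF P b
    ∃ˢ   : ∀ {b} → PF P b → SF P b

  data PF (P : Set) : Bool → Set₁ where
    st   : ∀ {b} → SF P b → PF P b
    ¬ᵖ   : ∀ {b} → PF P b → PF P b
    ⋀ᵖ   : ∀ {b} → (I : Set) → (I → PF P b) → PF P b
    _U_  : ∀ {b} → PF P b → PF P b → PF P b
    ∞    : PF P true

⊤ˢ : ∀ {P b} → SF P b
⊤ˢ = ⋀ˢ ⊥ ⊥-elim

_∧ˢ_ : ∀ {P b} → SF P b → SF P b → SF P b
φ ∧ˢ ψ = ⋀ˢ Bool (λ c → if c then φ else ψ)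

_∧ᵖ_ : ∀ {P b} → PF P b → PF P b → PF P b
φ ∧ᵖ ψ = ⋀ᵖ Bool (λ c → if c then φ else ψ)

_∨ᵖ_ : ∀ {P b} → PF P b → PF P b → PF P b
φ ∨ᵖ ψ = ¬ᵖ (¬ᵖ φ ∧ᵖ ¬ᵖ ψ)

Fᵖ : ∀ {P b} → PF P b → PF P b
Fᵖ ψ = st ⊤ˢ U ψ

Gᵖ : ∀ {P b} → PF P b → PF P b
Gᵖ ψ = ¬ᵖ (Fᵖ (¬ᵖ ψ))

-- Semantics. Path formulas are evaluated at a position i of a path,
-- i.e. on the suffix of π obtained by deleting the first i states.

module _ {Q : Set} (K : Kripke Q) where
  mutual
    _⊨ˢ_ : ∀ {b} → State K → SF Q b → Set
    s ⊨ˢ atom p   = L K s p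
    s ⊨ˢ ¬ˢ φ     = ¬ (s ⊨ˢ φ)
    s ⊨ˢ ⋀ˢ I φs  = (i : I) → s ⊨ˢ φs i
    s ⊨ˢ ∃ˢ ψ     = Σ (Path K) λ π → Maximal π × (seq π 0 ≡ s) × sat π 0 ψ

    sat : ∀ {b} → Path K → ℕ → PF Q b → Set
    sat π i (st φ)    = seq π i ⊨ˢ φ
    sat π i (¬ᵖ ψ)    = ¬ sat π i ψ
    sat π i (⋀ᵖ I ψs) = (j : I) → sat π i (ψs j)
    sat π i (ψ U ψ')  = Σ ℕ λ k → InRange (len π) k × i ≤ k × sat π k ψ'
                          × (∀ j → i ≤ j → j < k → sat π j ψ)
    sat π i ∞         = len π ≡ inf

-- Deadlock extension D(K): s_δ = nothing, δ = nothing.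

DK : {AP : Set} → Kripke AP → Kripke (Maybe AP)
DK {AP} K = record { State = Maybe (State K) ; L = Lδ ; _⟶_ = Tδ }
  where
  Lδ : Maybe (State K) → Maybe AP → Set
  Lδ (just s) (just p) = L K s p
  Lδ (just s) nothing  = ⊥
  Lδ nothing  (just p) = ⊥
  Lδ nothing  nothing  = ⊤
  Tδ : Maybe (State K) → Maybe (State K) → Set
  Tδ (just s) (just t) = _⟶_ K s t
  Tδ (just d) nothing  = ¬ (Σ (State K) λ t → _⟶_ K d t)
  Tδ nothing  (just t) = ⊥
  Tδ nothing  nothing  = ⊤

Kδ : (AP : Set) → Kripke (Maybe AP)
Kδ AP = record { State = ⊤ ; L = Lδ ; _⟶_ = λ _ _ → ⊤ }
  where
  Lδ : ⊤ → Maybe AP → Set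
  Lδ _ (just _) = ⊥
  Lδ _ nothing  = ⊤

δˢ : ∀ {AP b} → SF (Maybe AP) b
δˢ = atom nothing

mutual
  Dˢ : ∀ {AP} → SF AP true → SF (Maybe AP) false
  Dˢ (atom p)   = atom (just p)
  Dˢ (¬ˢ φ)     = ¬ˢ δˢ ∧ˢ ¬ˢ (Dˢ φ)
  Dˢ (⋀ˢ I φs)  = ⋀ˢ I (λ i → Dˢ (φs i))
  Dˢ (∃ˢ ψ)     = ∃ˢ (Dᵖ ψ)

  Dᵖ : ∀ {AP} → PF AP true → PF (Maybe AP) false
  Dᵖ (st φ)     = st (Dˢ φ)
  Dᵖ (¬ᵖ ψ)     = st (¬ˢ δˢ) ∧ᵖ ¬ᵖ (Dᵖ ψ)
  Dᵖ (⋀ᵖ I ψs)  = ⋀ᵖ I (λ i → Dᵖ (ψs i))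
  Dᵖ (ψ U ψ')   = Dᵖ ψ U Dᵖ ψ'
  Dᵖ ∞          = ¬ᵖ (Fᵖ (st δˢ))

module _ (lem : ExcludedMiddle 0ℓ) where
  mutual
    Eˢ : ∀ {AP} → SF (Maybe AP) false → SF AP true
    Eˢ (atom (just p)) = atom p
    Eˢ (atom nothing)  = ¬ˢ ⊤ˢ
    Eˢ (¬ˢ φ)          = ¬ˢ (Eˢ φ)
    Eˢ (⋀ˢ I φs)       = ⋀ˢ I (λ i → Eˢ (φs i))
    Eˢ (∃ˢ ψ)          = ∃ˢ (Eᵖ ψ)

    Eᵖ : ∀ {AP} → PF (Maybe AP) false → PF AP true
    Eᵖ (st φ)    = st (Eˢ φ)
    Eᵖ (¬ᵖ ψ)    = ¬ᵖ (Eᵖ ψ)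
    Eᵖ (⋀ᵖ I ψs) = ⋀ᵖ I (λ i → Eᵖ (ψs i))
    Eᵖ {AP} (ψ U ψ') =
      if does (lem {_⊨ˢ_ (Kδ AP) tt (∃ˢ ψ')})
        then (((¬ᵖ ∞) ∧ᵖ Gᵖ (Eᵖ ψ)) ∨ᵖ (Eᵖ ψ U Eᵖ ψ'))
        else (Eᵖ ψ U Eᵖ ψ')

-- A maximal path of K from s corresponds to the unique maximal path of D(K) that follows it
-- and then, if it is finite, loops in s_δ forever; every maximal path of D(K) is infinite and
-- arises in this way. Along the s_δ-tail every formula evaluates as in the one-state structure
-- Kδ, so only the until operator needs care: a witness lying in the tail is replaced, for D,
-- by the last state of the finite path (a D-formula true at s_δ is true everywhere), and for E,
-- by the extra disjunct ¬∞ ∧ G ψ, which says precisely that such a tail exists and ψ holds until it.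
module Submission where

open import Defs
open import Level using (0ℓ)
open import Axiom.ExcludedMiddle using (ExcludedMiddle)
open import Axiom.DoubleNegationElimination using (em⇒dne)
open import Data.Bool using (Bool; true; false; if_then_else_)
open import Data.Empty using (⊥; ⊥-elim)
open import Data.Maybe using (Maybe; just; nothing; fromMaybe)
open import Data.Maybe.Properties using (just-injective)
open import Data.Nat using (ℕ; zero; suc; _+_; _≤_; _<_; z≤n; _≤′_; ≤′-refl; ≤′-step; _≤?_)
open import Data.Nat.Properties
  using (≤-refl; ≤-trans; ≤-antisym; ≤-pred; <⇒≤; <⇒≱; ≰⇒>; ≮⇒≥; ≤-<-trans; m≤n⇒m≤1+n; ≤⇒≤′)
open import Data.Product using (Σ; _×_; _,_; proj₂)
open import Data.Product.Function.NonDependent.Propositional using (_×-⇔_)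
open import Data.Sum using (_⊎_; inj₁; inj₂; [_,_])
open import Data.Sum.Function.Propositional using (_⊎-⇔_)
open import Data.Unit using (⊤; tt)
open import Function.Bundles using (_⇔_; mk⇔; Equivalence)
import Function.Properties.Equivalence as ⇔
open import Function.Related.TypeIsomorphisms using (¬-cong-⇔)
open import Relation.Nullary using (¬_; Dec; yes; no; does)
open import Relation.Binary.PropositionalEquality using (_≡_; _≢_; refl; sym; trans; cong; subst; subst₂)

open Equivalence using (to; from)

Π-cong-⇔ : {I : Set} {A B : I → Set} → (∀ i → A i ⇔ B i) → ((i : I) → A i) ⇔ ((i : I) → B i)
Π-cong-⇔ A⇔B = mk⇔ (λ h i → to (A⇔B i) (h i)) (λ h i → from (A⇔B i) (h i))

⊎-absorbˡ-⇔ : {A B : Set} → (A → B) → (A ⊎ B) ⇔ B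
⊎-absorbˡ-⇔ A→B = mk⇔ [ A→B , (λ b → b) ] inj₂

≢nothing⇒≡just : {A : Set} (a : A) {m : Maybe A} → m ≢ nothing → m ≡ just (fromMaybe a m)
≢nothing⇒≡just a {just x}  _ = refl
≢nothing⇒≡just a {nothing} m≢nothing = ⊥-elim (m≢nothing refl)

InRange-0 : ∀ l → InRange l 0
InRange-0 (fin n) = z≤n
InRange-0 inf     = tt

InRange-≤ : ∀ l {j k} → j ≤ k → InRange l k → InRange l j
InRange-≤ (fin n) j≤k k≤n = ≤-trans j≤k k≤n
InRange-≤ inf     _   _   = tt

InRange-inf : ∀ {l} → l ≡ inf → ∀ k → InRange l k
InRange-inf refl k = tt

InRange? : ∀ l k → Dec (InRange l k)
InRange? (fin n) k = k ≤? n
InRange? inf     k = yes tt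

¬InRange⇒fin : ∀ l {k} → ¬ InRange l k → Σ ℕ λ n → l ≡ fin n × n < k
¬InRange⇒fin (fin n) k≰n = n , refl , ≰⇒> k≰n
¬InRange⇒fin inf     ¬tt = ⊥-elim (¬tt tt)

just≢nothing : {A : Set} {x : A} → just x ≢ nothing
just≢nothing ()

fin≢inf : ∀ {n} → fin n ≢ inf
fin≢inf ()

¬inf⇒fin : ∀ {l} → ¬ l ≡ inf → Σ ℕ λ n → l ≡ fin n
¬inf⇒fin {fin n} _    = n , refl
¬inf⇒fin {inf}   l≢∞ = ⊥-elim (l≢∞ refl)

-- sat M π i (ψ U ψ′) is definitionally Until (len π) (λ j → sat M π j ψ) (λ j → sat M π j ψ′) i.
Until : Len → (ℕ → Set) → (ℕ → Set) → ℕ → Set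
Until l P Q i = Σ ℕ λ k → InRange l k × i ≤ k × Q k × (∀ j → i ≤ j → j < k → P j)

Always : Len → (ℕ → Set) → ℕ → Set
Always l P i = ∀ j → InRange l j → i ≤ j → P j

Until-now : ∀ {l P Q i} → InRange l i → Q i → Until l P Q i
Until-now {i = i} r q = i , r , ≤-refl , q , λ j i≤j j<i → ⊥-elim (<⇒≱ j<i i≤j)

Until-map : ∀ {l P P′ Q Q′ i} → (∀ j → InRange l j → P j → P′ j) → (∀ j → InRange l j → Q j → Q′ j) →
            Until l P Q i → Until l P′ Q′ i
Until-map {l} P→P′ Q→Q′ (k , r , i≤k , q , p) =
  k , r , i≤k , Q→Q′ k r q , λ j i≤j j<k → P→P′ j (InRange-≤ l (<⇒≤ j<k) r) (p j i≤j j<k)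

Until-cong : ∀ {l P P′ Q Q′ i} → (∀ j → InRange l j → P j ⇔ P′ j) → (∀ j → InRange l j → Q j ⇔ Q′ j) →
             Until l P Q i ⇔ Until l P′ Q′ i
Until-cong P⇔P′ Q⇔Q′ =
  mk⇔ (Until-map (λ j r → to (P⇔P′ j r)) (λ j r → to (Q⇔Q′ j r)))
      (Until-map (λ j r → from (P⇔P′ j r)) (λ j r → from (Q⇔Q′ j r)))

Always-cong : ∀ {l P P′ i} → (∀ j → InRange l j → P j ⇔ P′ j) → Always l P i ⇔ Always l P′ i
Always-cong P⇔P′ =
  mk⇔ (λ h j r i≤j → to (P⇔P′ j r) (h j r i≤j)) (λ h j r i≤j → from (P⇔P′ j r) (h j r i≤j))

module _ {Q : Set} {M : Kripke Q} where

  step-inf : (π : Path M) → len π ≡ inf → ∀ k → _⟶_ M (seq π k) (seq π (suc k))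
  step-inf π π-inf k = step π k (InRange-inf π-inf (suc k))

  inf⇒Maximal : (π : Path M) → len π ≡ inf → Maximal π
  inf⇒Maximal record { len = inf } refl = tt

  suffix : (π : Path M) → len π ≡ inf → ℕ → Path M
  suffix π π-inf m =
    record { len = inf ; seq = λ k → seq π (k + m) ; step = λ k _ → step-inf π π-inf (k + m) }

  module _ {π : Path M} {i : ℕ} {b : Bool} {ψ ψ′ : PF Q b} where

    sat-∧ᵖ : sat M π i (ψ ∧ᵖ ψ′) ⇔ (sat M π i ψ × sat M π i ψ′)
    sat-∧ᵖ = mk⇔ (λ h → h true , h false) (λ { (p , _) true → p ; (_ , p′) false → p′ })

    sat-∨ᵖ : ExcludedMiddle 0ℓ → sat M π i (ψ ∨ᵖ ψ′) ⇔ (sat M π i ψ ⊎ sat M π i ψ′)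
    sat-∨ᵖ lem = mk⇔
      (λ h → em⇒dne lem λ neither → h λ { true → λ p → neither (inj₁ p) ; false → λ p′ → neither (inj₂ p′) })
      (λ { (inj₁ p) h → h true p ; (inj₂ p′) h → h false p′ })

  sat-Gᵖ : ExcludedMiddle 0ℓ → {π : Path M} {i : ℕ} {b : Bool} {ψ : PF Q b} →
           sat M π i (Gᵖ ψ) ⇔ Always (len π) (λ j → sat M π j ψ) i
  sat-Gᵖ lem = mk⇔ (λ h j r i≤j → em⇒dne lem λ ¬p → h (j , r , i≤j , ¬p , λ _ _ _ ()))
                   (λ h (k , r , i≤k , ¬p , _) → ¬p (h k r i≤k))

module _ {AP : Set} where

  Kδ-loop : Path (Kδ AP)
  Kδ-loop = record { len = inf ; seq = λ _ → tt ; step = λ _ _ → tt }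

  Kδ-Maximal⇒inf : (κ : Path (Kδ AP)) → Maximal κ → len κ ≡ inf
  Kδ-Maximal⇒inf record { len = fin n } stuck = ⊥-elim (stuck (tt , tt))
  Kδ-Maximal⇒inf record { len = inf }   _     = refl

module _ {AP : Set} (K : Kripke AP) where

  private
    D  = DK K
    SK = State K

  nothing-⟶ : ∀ {x} → _⟶_ D nothing x → x ≡ nothing
  nothing-⟶ {nothing} _ = refl

  DK-not-deadlocked : (x : Maybe SK) → ¬ ¬ Σ (Maybe SK) (_⟶_ D x)
  DK-not-deadlocked nothing  stuck = stuck (nothing , tt)
  DK-not-deadlocked (just x) stuck = stuck (nothing , λ (t , x⟶t) → stuck (just t , x⟶t))

  DK-Maximal⇒inf : (ρ : Path D) → Maximal ρ → len ρ ≡ inf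
  DK-Maximal⇒inf record { len = inf }              _     = refl
  DK-Maximal⇒inf record { len = fin n ; seq = ρ } stuck = ⊥-elim (DK-not-deadlocked (ρ n) stuck)

  δ-loop : Path D
  δ-loop = record { len = inf ; seq = λ _ → nothing ; step = λ _ _ → tt }

  δ-absorbing : (ρ : Path D) → len ρ ≡ inf → ∀ {i j} → seq ρ i ≡ nothing → i ≤ j → seq ρ j ≡ nothing
  δ-absorbing ρ ρ-inf ρi≡δ i≤j = go (≤⇒≤′ i≤j)
    where
    go : ∀ {j} → _ ≤′ j → seq ρ j ≡ nothing
    go ≤′-refl         = ρi≡δ
    go (≤′-step {j} p) = nothing-⟶ (subst (λ x → _⟶_ D x (seq ρ (suc j))) (go p) (step-inf ρ ρ-inf j))

  mutual
    δ-⊨ˢ⇔Kδ : ∀ {b} (φ : SF (Maybe AP) b) → _⊨ˢ_ D nothing φ ⇔ _⊨ˢ_ (Kδ AP) tt φ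
    δ-⊨ˢ⇔Kδ (atom (just p)) = mk⇔ (λ ()) (λ ())
    δ-⊨ˢ⇔Kδ (atom nothing)  = ⇔.refl
    δ-⊨ˢ⇔Kδ (¬ˢ φ)          = ¬-cong-⇔ (δ-⊨ˢ⇔Kδ φ)
    δ-⊨ˢ⇔Kδ (⋀ˢ I φs)       = Π-cong-⇔ λ j → δ-⊨ˢ⇔Kδ (φs j)
    δ-⊨ˢ⇔Kδ (∃ˢ ψ)          = mk⇔
      (λ (ρ , ρ-max , ρ0≡δ , h) →
         Kδ-loop , tt , refl , to (δ-sat⇔Kδ ψ ρ (DK-Maximal⇒inf ρ ρ-max) ρ0≡δ Kδ-loop refl 0) h)
      (λ (κ , κ-max , _ , h) →
         δ-loop , tt , refl , from (δ-sat⇔Kδ ψ δ-loop refl refl κ (Kδ-Maximal⇒inf κ κ-max) 0) h)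

    δ-sat⇔Kδ : ∀ {b} (ψ : PF (Maybe AP) b) (ρ : Path D) → len ρ ≡ inf → ∀ {i} → seq ρ i ≡ nothing →
               (κ : Path (Kδ AP)) → len κ ≡ inf → ∀ m → sat D ρ i ψ ⇔ sat (Kδ AP) κ m ψ
    δ-sat⇔Kδ (st φ) ρ _ ρi≡δ _ _ _ rewrite ρi≡δ = δ-⊨ˢ⇔Kδ φ
    δ-sat⇔Kδ (¬ᵖ ψ) ρ ρ-inf ρi≡δ κ κ-inf m = ¬-cong-⇔ (δ-sat⇔Kδ ψ ρ ρ-inf ρi≡δ κ κ-inf m)
    δ-sat⇔Kδ (⋀ᵖ I ψs) ρ ρ-inf ρi≡δ κ κ-inf m = Π-cong-⇔ λ j → δ-sat⇔Kδ (ψs j) ρ ρ-inf ρi≡δ κ κ-inf m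
    δ-sat⇔Kδ (ψ U ψ′) ρ ρ-inf {i} ρi≡δ κ κ-inf m = mk⇔
      (λ (k , _ , i≤k , ψ′k , _) → Until-now (InRange-inf κ-inf m)
         (to (δ-sat⇔Kδ ψ′ ρ ρ-inf (δ-absorbing ρ ρ-inf ρi≡δ i≤k) κ κ-inf m) ψ′k))
      (λ (k , _ , _ , ψ′k , _) → Until-now (InRange-inf ρ-inf i)
         (from (δ-sat⇔Kδ ψ′ ρ ρ-inf ρi≡δ κ κ-inf k) ψ′k))
    δ-sat⇔Kδ ∞ _ ρ-inf _ _ κ-inf _ = mk⇔ (λ _ → κ-inf) (λ _ → ρ-inf)

  -- A D-translation true in Kδ contains no atom and no negation outside an ∃, so it holds anywhere.
  mutual
    Kδ⊨Dˢ⇒⊨Dˢ : (φ : SF AP true) → _⊨ˢ_ (Kδ AP) tt (Dˢ φ) →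
                (ρ : Path D) → len ρ ≡ inf → ∀ m → _⊨ˢ_ D (seq ρ m) (Dˢ φ)
    Kδ⊨Dˢ⇒⊨Dˢ (atom p)  ()
    Kδ⊨Dˢ⇒⊨Dˢ (¬ˢ φ)    h = ⊥-elim (h true tt)
    Kδ⊨Dˢ⇒⊨Dˢ (⋀ˢ I φs) h ρ ρ-inf m j = Kδ⊨Dˢ⇒⊨Dˢ (φs j) (h j) ρ ρ-inf m
    Kδ⊨Dˢ⇒⊨Dˢ (∃ˢ ψ) (κ , κ-max , _ , h) ρ ρ-inf m =
      suffix ρ ρ-inf m , tt , refl , Kδ⊨Dᵖ⇒⊨Dᵖ ψ κ (Kδ-Maximal⇒inf κ κ-max) h (suffix ρ ρ-inf m) refl 0

    Kδ⊨Dᵖ⇒⊨Dᵖ : (χ : PF AP true) (κ : Path (Kδ AP)) → len κ ≡ inf → ∀ {i} → sat (Kδ AP) κ i (Dᵖ χ) →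
                (ρ : Path D) → len ρ ≡ inf → ∀ m → sat D ρ m (Dᵖ χ)
    Kδ⊨Dᵖ⇒⊨Dᵖ (st φ)    κ _ h = Kδ⊨Dˢ⇒⊨Dˢ φ h
    Kδ⊨Dᵖ⇒⊨Dᵖ (¬ᵖ χ)    κ _ h = ⊥-elim (h true tt)
    Kδ⊨Dᵖ⇒⊨Dᵖ (⋀ᵖ I χs) κ κ-inf h ρ ρ-inf m j = Kδ⊨Dᵖ⇒⊨Dᵖ (χs j) κ κ-inf (h j) ρ ρ-inf m
    Kδ⊨Dᵖ⇒⊨Dᵖ (χ U χ′)  κ κ-inf (_ , _ , _ , χ′k , _) ρ ρ-inf m =
      Until-now (InRange-inf ρ-inf m) (Kδ⊨Dᵖ⇒⊨Dᵖ χ′ κ κ-inf χ′k ρ ρ-inf m)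
    Kδ⊨Dᵖ⇒⊨Dᵖ ∞ κ κ-inf {i} h = ⊥-elim (h (Until-now (InRange-inf κ-inf i) tt))

  live⇒¬δ : ∀ {x s} → x ≡ just s → ¬ _⊨ˢ_ D x (δˢ {b = false})
  live⇒¬δ refl ()

  dead⇒δ : ∀ {x} → x ≡ nothing → _⊨ˢ_ D x (δˢ {b = false})
  dead⇒δ refl = tt

  ¬δ∧ˢ-live : ∀ {b} {x s} {φ : SF (Maybe AP) b} → x ≡ just s →
              _⊨ˢ_ D x (¬ˢ δˢ ∧ˢ φ) ⇔ _⊨ˢ_ D x φ
  ¬δ∧ˢ-live x≡s = mk⇔ (λ h → h false) (λ { h true → live⇒¬δ x≡s ; h false → h })

  ¬δ∧ᵖ-live : ∀ {b} {ρ : Path D} {i s} {ψ : PF (Maybe AP) b} → seq ρ i ≡ just s →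
              sat D ρ i (st (¬ˢ δˢ) ∧ᵖ ψ) ⇔ sat D ρ i ψ
  ¬δ∧ᵖ-live ρi≡s = mk⇔ (λ h → h false) (λ { h true → live⇒¬δ ρi≡s ; h false → h })

  record Extends (π : Path K) (ρ : Path D) : Set where
    field
      infinite   : len ρ ≡ inf
      agrees     : ∀ i → InRange (len π) i → seq ρ i ≡ just (seq π i)
      deadlocked : ∀ i → ¬ InRange (len π) i → seq ρ i ≡ nothing
  open Extends

  extend : (π : Path K) → Maximal π → Σ (Path D) (Extends π)
  extend record { len = inf ; seq = π ; step = π-step } _ =
    record { len = inf ; seq = λ i → just (π i) ; step = λ k _ → π-step k tt } ,
    record { infinite = refl ; agrees = λ _ _ → refl ; deadlocked = λ _ ¬tt → ⊥-elim (¬tt tt) }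
  extend record { len = fin n ; seq = π ; step = π-step } π-stuck =
    record { len = inf ; seq = λ i → ρ i (i ≤? n) ; step = λ k _ → ρ-step k (k ≤? n) (suc k ≤? n) } ,
    record { infinite = refl ; agrees = agrees′ ; deadlocked = deadlocked′ }
    where
    ρ : ∀ i → Dec (i ≤ n) → Maybe SK
    ρ i (yes _) = just (π i)
    ρ i (no _)  = nothing
    ρ-step : ∀ k p q → _⟶_ D (ρ k p) (ρ (suc k) q)
    ρ-step k (yes _)   (yes k<n) = π-step k k<n
    ρ-step k (yes k≤n) (no k≮n)  rewrite ≤-antisym k≤n (≮⇒≥ k≮n) = π-stuck
    ρ-step k (no k≰n)  (yes k<n) = ⊥-elim (k≰n (<⇒≤ k<n))
    ρ-step k (no _)    (no _)    = tt
    agrees′ : ∀ i → i ≤ n → ρ i (i ≤? n) ≡ just (π i)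
    agrees′ i i≤n with i ≤? n
    ... | yes _   = refl
    ... | no i≰n = ⊥-elim (i≰n i≤n)
    deadlocked′ : ∀ i → ¬ i ≤ n → ρ i (i ≤? n) ≡ nothing
    deadlocked′ i i≰n with i ≤? n
    ... | yes i≤n = ⊥-elim (i≰n i≤n)
    ... | no _    = refl

  deadlocked-after : ∀ {π ρ n} → Extends π ρ → len π ≡ fin n → seq ρ (suc n) ≡ nothing
  deadlocked-after {π} c π-fin = deadlocked c _ λ r → <⇒≱ ≤-refl (subst (λ l → InRange l _) π-fin r)

  last-live : (ρ : Path D) → ∀ {s} → seq ρ 0 ≡ just s → ∀ k → seq ρ k ≡ nothing →
              Σ ℕ λ n → seq ρ n ≢ nothing × seq ρ (suc n) ≡ nothing
  last-live ρ ρ0≡s zero    ρ0≡δ = ⊥-elim (just≢nothing (trans (sym ρ0≡s) ρ0≡δ))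
  last-live ρ ρ0≡s (suc k) ρk≡δ with seq ρ k in ρk
  ... | nothing = last-live ρ ρ0≡s k ρk
  ... | just _  = k , (λ ρk≡δ′ → just≢nothing (trans (sym ρk) ρk≡δ′)) , ρk≡δ

  restrict : ExcludedMiddle 0ℓ → (ρ : Path D) → len ρ ≡ inf → ∀ {s} → seq ρ 0 ≡ just s →
             Σ (Path K) λ π → Maximal π × Extends π ρ
  restrict lem ρ ρ-inf {s} ρ0≡s with lem {Σ ℕ λ k → seq ρ k ≡ nothing}
  ... | no never =
    π , tt , record { infinite = ρ-inf ; agrees = λ i _ → live i ; deadlocked = λ _ ¬tt → ⊥-elim (¬tt tt) }
    where
    live : ∀ i → seq ρ i ≡ just (fromMaybe s (seq ρ i))
    live i = ≢nothing⇒≡just s λ ρi≡δ → never (i , ρi≡δ)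
    π : Path K
    π = record { len = inf ; seq = λ i → fromMaybe s (seq ρ i)
               ; step = λ k _ → subst₂ (_⟶_ D) (live k) (live (suc k)) (step-inf ρ ρ-inf k) }
  ... | yes (k , ρk≡δ) with last-live ρ ρ0≡s k ρk≡δ
  ... | n , ρn-live , ρ1+n≡δ =
    π , π-stuck , record { infinite = ρ-inf ; agrees = live ; deadlocked = dead }
    where
    live : ∀ i → i ≤ n → seq ρ i ≡ just (fromMaybe s (seq ρ i))
    live i i≤n = ≢nothing⇒≡just s λ ρi≡δ → ρn-live (δ-absorbing ρ ρ-inf ρi≡δ i≤n)
    dead : ∀ i → ¬ i ≤ n → seq ρ i ≡ nothing
    dead i i≰n = δ-absorbing ρ ρ-inf ρ1+n≡δ (≰⇒> i≰n)
    π : Path K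
    π = record { len = fin n ; seq = λ i → fromMaybe s (seq ρ i)
               ; step = λ k k<n → subst₂ (_⟶_ D) (live k (<⇒≤ k<n)) (live (suc k) k<n) (step-inf ρ ρ-inf k) }
    π-stuck : ¬ Σ SK (_⟶_ K (fromMaybe s (seq ρ n)))
    π-stuck = subst₂ (_⟶_ D) (live n ≤-refl) ρ1+n≡δ (step-inf ρ ρ-inf n)

  -- ψ holds all along the finite π, and ψ′ holds in its s_δ-tail.
  UntilInTail : Path K → Path D → ∀ {b} → PF (Maybe AP) b → PF (Maybe AP) b → ℕ → Set
  UntilInTail π ρ ψ ψ′ i = _⊨ˢ_ (Kδ AP) tt (∃ˢ ψ′) × ¬ len π ≡ inf × Always (len π) (λ j → sat D ρ j ψ) i

  module _ {π : Path K} {ρ : Path D} (c : Extends π ρ) where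

    until-on-extension : ∀ {b} (ψ ψ′ : PF (Maybe AP) b) {i} → InRange (len π) i →
      sat D ρ i (ψ U ψ′) ⇔ (UntilInTail π ρ ψ ψ′ i ⊎ Until (len π) (λ j → sat D ρ j ψ) (λ j → sat D ρ j ψ′) i)
    until-on-extension ψ ψ′ {i} r = mk⇔ split join
      where
      split : sat D ρ i (ψ U ψ′) →
              UntilInTail π ρ ψ ψ′ i ⊎ Until (len π) (λ j → sat D ρ j ψ) (λ j → sat D ρ j ψ′) i
      split (k , _ , i≤k , ψ′k , ψ<k) with InRange? (len π) k
      ... | yes rk = inj₂ (k , rk , i≤k , ψ′k , ψ<k)
      ... | no ¬rk with ¬InRange⇒fin (len π) ¬rk
      ... | n , π-fin , n<k = inj₁
        ( (Kδ-loop , tt , refl ,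
           to (δ-sat⇔Kδ ψ′ ρ (infinite c) (δ-absorbing ρ (infinite c) (deadlocked-after c π-fin) n<k)
                        Kδ-loop refl 0) ψ′k)
        , (λ π-inf → fin≢inf (trans (sym π-fin) π-inf))
        , λ j rj i≤j → ψ<k j i≤j (≤-<-trans (subst (λ l → InRange l j) π-fin rj) n<k))
      join : UntilInTail π ρ ψ ψ′ i ⊎ Until (len π) (λ j → sat D ρ j ψ) (λ j → sat D ρ j ψ′) i →
             sat D ρ i (ψ U ψ′)
      join (inj₂ (k , _ , i≤k , ψ′k , ψ<k)) = k , InRange-inf (infinite c) k , i≤k , ψ′k , ψ<k
      join (inj₁ ((κ , κ-max , _ , ψ′κ) , π-fin , ψ-always)) with ¬inf⇒fin π-fin
      ... | n , π≡n =
        suc n , InRange-inf (infinite c) (suc n) , m≤n⇒m≤1+n (subst (λ l → InRange l i) π≡n r) ,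
        from (δ-sat⇔Kδ ψ′ ρ (infinite c) (deadlocked-after c π≡n) κ (Kδ-Maximal⇒inf κ κ-max) 0) ψ′κ ,
        λ j i≤j j≤n → ψ-always j (subst (λ l → InRange l j) (sym π≡n) (≤-pred j≤n)) i≤j

  module _ (lem : ExcludedMiddle 0ℓ) where

    ∃-transfer : ∀ {b b′} (ψ : PF (Maybe AP) b) (ψ̂ : PF AP b′) →
                 (∀ {π ρ} → Extends π ρ → sat D ρ 0 ψ ⇔ sat K π 0 ψ̂) →
                 ∀ s → _⊨ˢ_ D (just s) (∃ˢ ψ) ⇔ _⊨ˢ_ K s (∃ˢ ψ̂)
    ∃-transfer ψ ψ̂ ψ⇔ψ̂ s = mk⇔
      (λ (ρ , ρ-max , ρ0≡s , h) →
         let (π , π-max , c) = restrict lem ρ (DK-Maximal⇒inf ρ ρ-max) ρ0≡s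
         in π , π-max , just-injective (trans (sym (agrees c 0 (InRange-0 (len π)))) ρ0≡s) , to (ψ⇔ψ̂ c) h)
      (λ (π , π-max , π0≡s , h) →
         let (ρ , c) = extend π π-max
         in ρ , inf⇒Maximal ρ (infinite c) , trans (agrees c 0 (InRange-0 (len π))) (cong just π0≡s) ,
            from (ψ⇔ψ̂ c) h)

    E-until-correct : ∀ {π ρ} → Extends π ρ → ∀ {i} → InRange (len π) i →
      (ψ ψ′ : PF (Maybe AP) false) {ψ̂ ψ̂′ : PF AP true} →
      (∀ j → InRange (len π) j → sat D ρ j ψ ⇔ sat K π j ψ̂) →
      (∀ j → InRange (len π) j → sat D ρ j ψ′ ⇔ sat K π j ψ̂′) →
      (δ⊨ψ′? : Dec (_⊨ˢ_ (Kδ AP) tt (∃ˢ ψ′))) →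
      sat D ρ i (ψ U ψ′) ⇔ sat K π i (if does δ⊨ψ′? then ((¬ᵖ ∞ ∧ᵖ Gᵖ ψ̂) ∨ᵖ (ψ̂ U ψ̂′)) else (ψ̂ U ψ̂′))
    E-until-correct c r ψ ψ′ ψ⇔ψ̂ ψ′⇔ψ̂′ (no δ⊭ψ′) =
      ⇔.trans (until-on-extension c ψ ψ′ r)
              (⇔.trans (⊎-absorbˡ-⇔ λ (δ⊨ψ′ , _) → ⊥-elim (δ⊭ψ′ δ⊨ψ′)) (Until-cong ψ⇔ψ̂ ψ′⇔ψ̂′))
    E-until-correct {π} {ρ} c {i} r ψ ψ′ {ψ̂} ψ⇔ψ̂ ψ′⇔ψ̂′ (yes δ⊨ψ′) =
      ⇔.trans (until-on-extension c ψ ψ′ r)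
              (⇔.trans (tail⇔ ⊎-⇔ Until-cong ψ⇔ψ̂ ψ′⇔ψ̂′) (⇔.sym (sat-∨ᵖ lem)))
      where
      tail⇔ : UntilInTail π ρ ψ ψ′ i ⇔ sat K π i (¬ᵖ ∞ ∧ᵖ Gᵖ ψ̂)
      tail⇔ = ⇔.trans (mk⇔ proj₂ (δ⊨ψ′ ,_))
                (⇔.trans (⇔.refl ×-⇔ Always-cong ψ⇔ψ̂)
                         (⇔.sym (⇔.trans sat-∧ᵖ (⇔.refl ×-⇔ sat-Gᵖ lem {π = π} {ψ = ψ̂}))))

    mutual
      Dˢ-correct : (φ : SF AP true) (s : SK) → _⊨ˢ_ K s φ ⇔ _⊨ˢ_ D (just s) (Dˢ φ)
      Dˢ-correct (atom p)  s = ⇔.refl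
      Dˢ-correct (¬ˢ φ)    s = ⇔.trans (¬-cong-⇔ (Dˢ-correct φ s)) (⇔.sym (¬δ∧ˢ-live refl))
      Dˢ-correct (⋀ˢ I φs) s = Π-cong-⇔ λ j → Dˢ-correct (φs j) s
      Dˢ-correct (∃ˢ ψ)    s = ⇔.sym (∃-transfer (Dᵖ ψ) ψ (λ c → ⇔.sym (Dᵖ-correct ψ c 0 (InRange-0 _))) s)

      Dᵖ-correct : (χ : PF AP true) {π : Path K} {ρ : Path D} → Extends π ρ →
                   ∀ i → InRange (len π) i → sat K π i χ ⇔ sat D ρ i (Dᵖ χ)
      Dᵖ-correct (st φ) {π} c i r rewrite agrees c i r = Dˢ-correct φ (seq π i)
      Dᵖ-correct (¬ᵖ χ) c i r =
        ⇔.trans (¬-cong-⇔ (Dᵖ-correct χ c i r)) (⇔.sym (¬δ∧ᵖ-live (agrees c i r)))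
      Dᵖ-correct (⋀ᵖ I χs) c i r = Π-cong-⇔ λ j → Dᵖ-correct (χs j) c i r
      Dᵖ-correct (χ U χ′) {π} {ρ} c i r =
        ⇔.trans (Until-cong (Dᵖ-correct χ c) (Dᵖ-correct χ′ c))
                (⇔.sym (⇔.trans (until-on-extension c (Dᵖ χ) (Dᵖ χ′) r) (⊎-absorbˡ-⇔ tail⇒end)))
        where
        -- Dᵖ χ′ holds in the tail, hence already at the last state of π.
        tail⇒end : UntilInTail π ρ (Dᵖ χ) (Dᵖ χ′) i →
                   Until (len π) (λ j → sat D ρ j (Dᵖ χ)) (λ j → sat D ρ j (Dᵖ χ′)) i
        tail⇒end ((κ , κ-max , _ , χ′κ) , π-fin , χ-always) with ¬inf⇒fin π-fin
        ... | n , π≡n = n , rn , subst (λ l → InRange l i) π≡n r ,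
          Kδ⊨Dᵖ⇒⊨Dᵖ χ′ κ (Kδ-Maximal⇒inf κ κ-max) χ′κ ρ (infinite c) n ,
          λ j i≤j j<n → χ-always j (InRange-≤ (len π) (<⇒≤ j<n) rn) i≤j
          where rn = subst (λ l → InRange l n) (sym π≡n) ≤-refl
      Dᵖ-correct ∞ {π} {ρ} c i r = mk⇔ inf⇒no-δ no-δ⇒inf
        where
        inf⇒no-δ : len π ≡ inf → sat D ρ i (Dᵖ ∞)
        inf⇒no-δ π-inf (k , _ , _ , δk , _) = live⇒¬δ (agrees c k (InRange-inf π-inf k)) δk
        no-δ⇒inf : sat D ρ i (Dᵖ ∞) → len π ≡ inf
        no-δ⇒inf no-δ with len π in π-len
        ... | inf   = refl
        ... | fin n = ⊥-elim (no-δ (suc n , InRange-inf (infinite c) (suc n) , m≤n⇒m≤1+n r ,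
                                    dead⇒δ (deadlocked-after c π-len) , λ _ _ _ ()))

    mutual
      Eˢ-correct : (φ : SF (Maybe AP) false) (s : SK) → _⊨ˢ_ D (just s) φ ⇔ _⊨ˢ_ K s (Eˢ lem φ)
      Eˢ-correct (atom (just p)) s = ⇔.refl
      Eˢ-correct (atom nothing)  s = mk⇔ (λ ()) (λ ¬⊤ → ⊥-elim (¬⊤ λ ()))
      Eˢ-correct (¬ˢ φ)          s = ¬-cong-⇔ (Eˢ-correct φ s)
      Eˢ-correct (⋀ˢ I φs)       s = Π-cong-⇔ λ j → Eˢ-correct (φs j) s
      Eˢ-correct (∃ˢ ψ)          s = ∃-transfer ψ (Eᵖ lem ψ) (λ c → Eᵖ-correct ψ c 0 (InRange-0 _)) s

      Eᵖ-correct : (ψ : PF (Maybe AP) false) {π : Path K} {ρ : Path D} → Extends π ρ →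
                   ∀ i → InRange (len π) i → sat D ρ i ψ ⇔ sat K π i (Eᵖ lem ψ)
      Eᵖ-correct (st φ) {π} c i r rewrite agrees c i r = Eˢ-correct φ (seq π i)
      Eᵖ-correct (¬ᵖ ψ) c i r = ¬-cong-⇔ (Eᵖ-correct ψ c i r)
      Eᵖ-correct (⋀ᵖ I ψs) c i r = Π-cong-⇔ λ j → Eᵖ-correct (ψs j) c i r
      Eᵖ-correct (ψ U ψ′) c i r =
        E-until-correct c r ψ ψ′ {Eᵖ lem ψ} {Eᵖ lem ψ′} (Eᵖ-correct ψ c) (Eᵖ-correct ψ′ c) lem

theorem8p5 : (lem : ExcludedMiddle 0ℓ) {AP : Set} (K : Kripke AP) (s : State K) →
    ((φ : SF AP true) → (_⊨ˢ_ K s φ ⇔ _⊨ˢ_ (DK K) (just s) (Dˢ φ)))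
    × ((φ : SF (Maybe AP) false) → (_⊨ˢ_ (DK K) (just s) φ ⇔ _⊨ˢ_ K s (Eˢ lem φ)))
theorem8p5 lem K s = (λ φ → Dˢ-correct K lem φ s) , (λ φ → Eˢ-correct K lem φ s)
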